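{- Let $D_1$ and $D_2$ be block designs built on the same finite set $V$, with $b_1$ and $b_2$ blocks respectively, and suppose $D_1$ and $D_2$ are friends. For each integer $n\ge 0$, let $z_n$ be the number of blocks of $D_1$ whose intersection with a (any) fixed block of $D_2$ has exactly $n$ elements, and let $w_n$ be the number of blocks of $D_2$ whose intersection with a (any) fixed block of $D_1$ has exactly $n$ elements. Then $b_2\, z_n = b_1\, w_n$ for every $n$, i.e. $\varphi(D_1,D_2)\,b_2=\varphi(D_2,D_1)\,b_1$ componentwise.
   Context: A block design with parameters $(v,b,r,k,\lambda)$ built on a finite set $V$ ($|V|=v$) is a list of $b$ blocks, each a $k$-subset of $V$, such that every element of $V$ lies in exactly $r$ blocks and every pair of distinct elements lies in exactly $\lambda$ blocks; designs are assumed simple (no repeated blocks). For a design $D$ with blocks $B_1,\dots,B_b$ of size $k$ and a set $M\subseteq V$, let $\varphi(D,M)=(z_0,z_1,\dots,z_k)$ where $z_j$ is the number of $s$ with $|M\cap B_s|=j$. Two block designs $D_1$ (blocks $D_1^1,\dots,D_1^{b_1}$) and $D_2$ (blocks $D_2^1,\dots,D_2^{b_2}$) on the same set $V$ are called friends if $\varphi(D_1,D_2^i)$ does not depend on $i$ and $\varphi(D_2,D_1^j)$ does not depend on $j$; these common values are denoted $\varphi(D_1,D_2)$ and $\varphi(D_2,D_1)$ (vectors indexed by intersection size, padded by zeros where needed). -}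

module Defs where

open import Data.Nat using (ℕ; _≟_)
open import Data.Fin using (Fin)
open import Data.Fin.Subset using (Subset; _∩_; ∣_∣)
open import Data.Fin.Subset.Properties using (_∈?_)
open import Data.Vec using (Vec; lookup; count)
open import Relation.Binary.PropositionalEquality using (_≡_; _≢_)
open import Relation.Nullary.Decidable using (_×-dec_)

-- φ bs M j = number of blocks B in bs with |M ∩ B| = j,
-- i.e. component j of φ(D,M) (defined for every j : ℕ; it is 0 for j > k,
-- which realises the zero padding).
φ : ∀ {v b} → Vec (Subset v) b → Subset v → ℕ → ℕ
φ bs M j = count (λ B → ∣ M ∩ B ∣ ≟ j) bs

record BlockDesign (v : ℕ) : Set where
  field
    b r k lam : ℕ
    blocks      : Vec (Subset v) b
    blockSize   : ∀ (s : Fin b) → ∣ lookup blocks s ∣ ≡ k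
    replication : ∀ (x : Fin v) → count (λ B → x ∈? B) blocks ≡ r
    balance     : ∀ (x y : Fin v) → x ≢ y →
                  count (λ B → (x ∈? B) ×-dec (y ∈? B)) blocks ≡ lam
    simple      : ∀ (s t : Fin b) → lookup blocks s ≡ lookup blocks t → s ≡ t

open BlockDesign public

Friends : ∀ {v} → BlockDesign v → BlockDesign v → Set
Friends D₁ D₂ =
  (∀ (i i' : Fin (b D₂)) (n : ℕ) →
     φ (blocks D₁) (lookup (blocks D₂) i) n ≡ φ (blocks D₁) (lookup (blocks D₂) i') n)
  × (∀ (j j' : Fin (b D₁)) (n : ℕ) →
     φ (blocks D₂) (lookup (blocks D₁) j) n ≡ φ (blocks D₂) (lookup (blocks D₁) j') n)
  where open import Data.Product using (_×_)

-- Double counting: the pairs (B₂, B₁) of a block of D₂ and a block of D₁ with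
-- |B₂ ∩ B₁| = n number ∑_{B₂} φ(D₁,B₂)(n) = ∑_{B₁} φ(D₂,B₁)(n).  For friends
-- every summand on the left is z_n and every summand on the right is w_n, so
-- both sides equal b₂ z_n = b₁ w_n.
module Submission where

open import Defs
open import Data.Bool using (Bool; true; false)
import Data.Nat as ℕ
open import Data.Nat using (ℕ; _*_; _+_; _≟_)
open import Data.Nat.Properties using (+-0-commutativeMonoid)
open import Data.Fin using (Fin; zero; suc)
open import Data.Fin.Subset using (Subset; _∩_; ∣_∣)
open import Data.Fin.Subset.Properties using (∩-comm)
open import Data.Vec using (Vec; []; _∷_; lookup; count)
open import Data.Vec.Functional using (Vector)
open import Function using (_∘_)
open import Data.Product using (_,_)
open import Relation.Nullary using (does)
open import Relation.Unary using (Pred; Decidable)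
open import Relation.Binary.PropositionalEquality
open import Algebra.Properties.CommutativeMonoid.Sum +-0-commutativeMonoid
  using (sum; sum-syntax; ∑-comm; sum-cong-≗)

indicator : Bool → ℕ
indicator true  = 1
indicator false = 0

count≡∑-indicator : ∀ {a p} {A : Set a} {P : Pred A p} (P? : Decidable P) {m} (xs : Vec A m) →
                    count P? xs ≡ ∑[ s < m ] indicator (does (P? (lookup xs s)))
count≡∑-indicator P? []       = refl
count≡∑-indicator P? (x ∷ xs) with does (P? x)
... | true  = cong ℕ.suc (count≡∑-indicator P? xs)
... | false = count≡∑-indicator P? xs

∑-constant : ∀ {m} (f : Vector ℕ m) {c : ℕ} → (∀ s → f s ≡ c) → sum f ≡ m * c
∑-constant {ℕ.zero}  f f≡c = refl
∑-constant {ℕ.suc m} f f≡c = cong₂ _+_ (f≡c zero) (∑-constant (f ∘ suc) (f≡c ∘ suc))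

φ≡∑-indicator : ∀ {v c} (Cs : Vec (Subset v) c) (M : Subset v) (n : ℕ) →
                φ Cs M n ≡ ∑[ t < c ] indicator (does (∣ M ∩ lookup Cs t ∣ ≟ n))
φ≡∑-indicator Cs M n = count≡∑-indicator (λ B → ∣ M ∩ B ∣ ≟ n) Cs

∑-φ-swap : ∀ {v a c} (As : Vec (Subset v) a) (Cs : Vec (Subset v) c) (n : ℕ) →
           ∑[ s < a ] φ Cs (lookup As s) n ≡ ∑[ t < c ] φ As (lookup Cs t) n
∑-φ-swap {a = a} {c} As Cs n = begin
  ∑[ s < a ] φ Cs (A s) n                 ≡⟨ sum-cong-≗ (λ s → φ≡∑-indicator Cs (A s) n) ⟩
  ∑[ s < a ] ∑[ t < c ] meets (A s) (C t) ≡⟨ ∑-comm (λ s t → meets (A s) (C t)) ⟩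
  ∑[ t < c ] ∑[ s < a ] meets (A s) (C t) ≡⟨ sum-cong-≗ (λ t → sum-cong-≗ (λ s → meets-comm (A s) (C t))) ⟩
  ∑[ t < c ] ∑[ s < a ] meets (C t) (A s) ≡⟨ sum-cong-≗ (λ t → φ≡∑-indicator As (C t) n) ⟨
  ∑[ t < c ] φ As (C t) n                 ∎
  where
  open ≡-Reasoning
  A = lookup As
  C = lookup Cs
  meets : Subset _ → Subset _ → ℕ
  meets X Y = indicator (does (∣ X ∩ Y ∣ ≟ n))
  meets-comm : ∀ X Y → meets X Y ≡ meets Y X
  meets-comm X Y = cong (λ Z → indicator (does (∣ Z ∣ ≟ n))) (∩-comm X Y)

proposition1 : ∀ {v : ℕ} (D₁ D₂ : BlockDesign v) → Friends D₁ D₂ →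
    ∀ (i : Fin (b D₂)) (j : Fin (b D₁)) (n : ℕ) →
      b D₂ * φ (blocks D₁) (lookup (blocks D₂) i) n
        ≡ b D₁ * φ (blocks D₂) (lookup (blocks D₁) j) n
proposition1 D₁ D₂ (φ₁-constant , φ₂-constant) i j n = begin
  b D₂ * φ (blocks D₁) (lookup (blocks D₂) i) n        ≡⟨ ∑-constant _ (λ s → φ₁-constant s i n) ⟨
  ∑[ s < b D₂ ] φ (blocks D₁) (lookup (blocks D₂) s) n ≡⟨ ∑-φ-swap (blocks D₂) (blocks D₁) n ⟩
  ∑[ t < b D₁ ] φ (blocks D₂) (lookup (blocks D₁) t) n ≡⟨ ∑-constant _ (λ t → φ₂-constant t j n) ⟩
  b D₁ * φ (blocks D₂) (lookup (blocks D₁) j) n        ∎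
  where open ≡-Reasoning
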